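{- Let $\nu,m,n$ be nonnegative integers with $m+n>0$. Then, as polynomials in $x$, $$\sum_{j=0}^{m}\binom{m}{j}\binom{n+j}{\nu}B_{n+j-\nu}(x)=\sum_{k=0}^{n}(-1)^{n-k}\binom{n}{k}\binom{m+k}{\nu}B_{m+k-\nu}(x+1).$$
   Context: The Bernoulli polynomials $B_n(x)$ are defined by $\frac{te^{xt}}{e^t-1}=\sum_{n\ge0}B_n(x)\frac{t^n}{n!}$. Summands in which the binomial coefficient vanishes (i.e. $\nu>n+j$ or $\nu>m+k$, so that the index of $B$ would be negative) are interpreted as $0$. -}

module Defs where

open import Data.Nat as ℕ using (ℕ; zero; suc)
open import Data.Nat.Combinatorics using (_C_)
open import Data.Integer using (+_)
open import Data.List using (List; []; _∷_; _++_)
open import Data.Rational using (ℚ; 0ℚ; 1ℚ; _+_; _*_; -_; _/_)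

toℚ : ℕ → ℚ
toℚ n = + n / 1

sumℚ : ℕ → (ℕ → ℚ) → ℚ
sumℚ zero    f = 0ℚ
sumℚ (suc n) f = sumℚ n f + f n

powℚ : ℚ → ℕ → ℚ
powℚ x zero    = 1ℚ
powℚ x (suc n) = powℚ x n * x

signℚ : ℕ → ℚ
signℚ zero    = 1ℚ
signℚ (suc n) = - signℚ n

idx : List ℚ → ℕ → ℚ
idx []       _       = 0ℚ
idx (a ∷ as) zero    = a
idx (a ∷ as) (suc k) = idx as k

-- bernList n = [B_0, …, B_n], Bernoulli numbers B_k = B_k(0) for the generating
-- function t/(e^t - 1) (so B_1 = -1/2), computed by the recurrence obtained by
-- comparing coefficients in t = (e^t - 1) · Σ B_k t^k/k! :
--   B_0 = 1,  Σ_{k=0}^{n} C(n+1,k) B_k = 0  (n ≥ 1).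
bernList : ℕ → List ℚ
bernList zero    = 1ℚ ∷ []
bernList (suc n) = prev ++ (new ∷ [])
  where
  prev : List ℚ
  prev = bernList n
  new : ℚ
  new = - ((+ 1 / suc (suc n)) * sumℚ (suc n) (λ k → toℚ (suc (suc n) C k) * idx prev k))

bernoulliNumber : ℕ → ℚ
bernoulliNumber n = idx (bernList n) n

-- Bernoulli polynomial B_n(x) = Σ_{k=0}^{n} C(n,k) B_k x^{n-k}
-- (equivalent to t e^{xt}/(e^t-1) = Σ B_n(x) t^n/n!), evaluated at x ∈ ℚ.
bernoulliPoly : ℕ → ℚ → ℚ
bernoulliPoly n x = sumℚ (suc n) (λ k → toℚ (n C k) * bernoulliNumber k * powℚ x (n ℕ.∸ k))

-- Write (a ⋆ b)(N) = Σₖ C(N,k) aₖ b_{N-k} for the binomial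
-- convolution of sequences ℕ → ℚ.  By definition B_N(x) = (B ⋆ xᵖᵒʷ)(N), and
-- C(N,ν) B_{N-ν}(x) = (δ_ν ⋆ (B ⋆ xᵖᵒʷ))(N) where δ_ν is the indicator of ν.
-- The whole argument is calculus of ⋆:
--   * the Leibniz rule (a ⋆ b)(N+1) = (a⁺ ⋆ b)(N) + (a ⋆ b⁺)(N), with a⁺ the
--     shifted sequence, yields by induction that ⋆ is commutative and
--     left-commutative, and the binomial theorem (x+1)ᴺ = (𝟙 ⋆ xᵖᵒʷ)(N);
--   * hence, writing Q_y(N) = C(N,ν) B_{N-ν}(y), the Appell property
--     Q_{x+1} = 𝟙 ⋆ Q_x holds (it needs nothing about the Bernoulli numbers);
--   * for any sequence q, the n-th forward difference of 𝟙 ⋆ q at m is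
--     Σₖ C(n,k)(-1)^{n-k} (𝟙 ⋆ q)(m+k) = Σⱼ C(m,j) q(n+j), again by Leibniz.
-- The theorem is this last identity for q = Q_x, rewritten with Q_{x+1} = 𝟙 ⋆ Q_x.
module Submission where

open import Defs
open import Data.Nat as ℕ using (ℕ; zero; suc; _<_; s≤s)
import Data.Nat.Properties as ℕP
open import Data.Nat.Combinatorics using (_C_; k>n⇒nCk≡0; nCk+nC[k+1]≡[n+1]C[k+1])
open import Data.Integer using (+_)
import Data.Integer as ℤ
import Data.Integer.Properties as ℤP
open import Data.Rational using (ℚ; 0ℚ; 1ℚ; _+_; _*_; -_; mkℚ; toℚᵘ)
open import Data.Rational.Properties
  using (toℚᵘ-injective; toℚᵘ-cong; toℚᵘ-homo-+; normalize-coprime; +-comm; *-comm; *-zeroˡ; *-identityʳ; *-distribʳ-+)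
import Data.Rational.Unnormalised as U
import Data.Rational.Unnormalised.Properties as UP
open import Data.Rational.Solver using (module +-*-Solver)
open import Data.Nat.Coprimality using (1-coprimeTo) renaming (sym to coprime-sym)
open import Relation.Binary.PropositionalEquality
open import Relation.Nullary using (yes; no)

open +-*-Solver

toℚ-+ : ∀ a b → toℚ (a ℕ.+ b) ≡ toℚ a + toℚ b
toℚ-+ a b = toℚᵘ-injective (begin
  toℚᵘ (toℚ (a ℕ.+ b))                ≈⟨ toℚᵘ-cong (toℚ≡mkℚ (a ℕ.+ b)) ⟩
  U.mkℚᵘ (+ (a ℕ.+ b)) 0               ≈⟨ U.*≡* cross-multiplied ⟩
  U.mkℚᵘ (+ a) 0 U.+ U.mkℚᵘ (+ b) 0    ≈⟨ UP.+-cong (toℚᵘ-cong (sym (toℚ≡mkℚ a))) (toℚᵘ-cong (sym (toℚ≡mkℚ b))) ⟩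
  toℚᵘ (toℚ a) U.+ toℚᵘ (toℚ b)        ≈⟨ UP.≃-sym (toℚᵘ-homo-+ (toℚ a) (toℚ b)) ⟩
  toℚᵘ (toℚ a + toℚ b)                 ∎)
  where
  open UP.≃-Reasoning
  toℚ≡mkℚ : ∀ n → toℚ n ≡ mkℚ (+ n) 0 (coprime-sym (1-coprimeTo n))
  toℚ≡mkℚ n = normalize-coprime (coprime-sym (1-coprimeTo n))
  cross-multiplied : + (a ℕ.+ b) ℤ.* + 1 ≡ (+ a ℤ.* + 1 ℤ.+ + b ℤ.* + 1) ℤ.* + 1
  cross-multiplied rewrite ℤP.*-identityʳ (+ a) | ℤP.*-identityʳ (+ b)
                         | ℤP.*-identityʳ (+ (a ℕ.+ b)) = refl

pascal : ∀ N k → toℚ (N C k) + toℚ (N C suc k) ≡ toℚ (suc N C suc k)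
pascal N k = trans (sym (toℚ-+ (N C k) (N C suc k))) (cong toℚ (nCk+nC[k+1]≡[n+1]C[k+1] N k))

sum-cong : ∀ n {f g : ℕ → ℚ} → (∀ k → k < n → f k ≡ g k) → sumℚ n f ≡ sumℚ n g
sum-cong zero    f≡g = refl
sum-cong (suc n) f≡g =
  cong₂ _+_ (sum-cong n (λ k k<n → f≡g k (ℕP.m<n⇒m<1+n k<n))) (f≡g n (ℕP.n<1+n n))

sum-cong′ : ∀ n {f g : ℕ → ℚ} → (∀ k → f k ≡ g k) → sumℚ n f ≡ sumℚ n g
sum-cong′ n f≡g = sum-cong n (λ k _ → f≡g k)

sum-+ : ∀ n (f g : ℕ → ℚ) → sumℚ n (λ k → f k + g k) ≡ sumℚ n f + sumℚ n g
sum-+ zero    f g = refl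
sum-+ (suc n) f g rewrite sum-+ n f g =
  solve 4 (λ a b c d → a :+ b :+ (c :+ d) := a :+ c :+ (b :+ d)) refl (sumℚ n f) (sumℚ n g) (f n) (g n)

sum-*ʳ : ∀ n (f : ℕ → ℚ) c → sumℚ n (λ k → f k * c) ≡ sumℚ n f * c
sum-*ʳ zero    f c = solve 1 (λ c → con 0ℚ := con 0ℚ :* c) refl c
sum-*ʳ (suc n) f c rewrite sum-*ʳ n f c = sym (*-distribʳ-+ c (sumℚ n f) (f n))

sum-first : ∀ n (f : ℕ → ℚ) → sumℚ (suc n) f ≡ f 0 + sumℚ n (λ k → f (suc k))
sum-first zero    f = solve 1 (λ a → con 0ℚ :+ a := a :+ con 0ℚ) refl (f 0)
sum-first (suc n) f rewrite sum-first n f =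
  solve 3 (λ a b c → a :+ b :+ c := a :+ (b :+ c)) refl (f 0) (sumℚ n (λ k → f (suc k))) (f (suc n))

Seq : Set
Seq = ℕ → ℚ

infixl 7 _⋆_

_⋆_ : Seq → Seq → Seq
(a ⋆ b) N = sumℚ (suc N) (λ k → toℚ (N C k) * a k * b (N ℕ.∸ k))

-- The shifted sequence a⁺, playing the role of the derivative.
shift : Seq → Seq
shift a k = a (suc k)

⋆-at-0 : ∀ (a b : Seq) → (a ⋆ b) 0 ≡ a 0 * b 0
⋆-at-0 a b = solve 2 (λ u v → con 0ℚ :+ con 1ℚ :* u :* v := u :* v) refl (a 0) (b 0)

⋆-congˡ : ∀ {a a′} (b : Seq) → (∀ k → a k ≡ a′ k) → ∀ N → (a ⋆ b) N ≡ (a′ ⋆ b) N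
⋆-congˡ b a≡a′ N = sum-cong′ (suc N) (λ k → cong (λ u → toℚ (N C k) * u * b (N ℕ.∸ k)) (a≡a′ k))

⋆-congʳ : ∀ (a : Seq) {b b′} → (∀ k → b k ≡ b′ k) → ∀ N → (a ⋆ b) N ≡ (a ⋆ b′) N
⋆-congʳ a b≡b′ N = sum-cong′ (suc N) (λ k → cong (λ v → toℚ (N C k) * a k * v) (b≡b′ (N ℕ.∸ k)))

⋆-distribʳ : ∀ (a b b′ : Seq) N → (a ⋆ (λ k → b k + b′ k)) N ≡ (a ⋆ b) N + (a ⋆ b′) N
⋆-distribʳ a b b′ N = trans
  (sum-cong′ (suc N) (λ k → solve 4 (λ c u v w → c :* u :* (v :+ w) := c :* u :* v :+ c :* u :* w)
    refl (toℚ (N C k)) (a k) (b (N ℕ.∸ k)) (b′ (N ℕ.∸ k))))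
  (sum-+ (suc N) _ _)

⋆-scaleʳ : ∀ (a b : Seq) c N → (a ⋆ (λ k → b k * c)) N ≡ (a ⋆ b) N * c
⋆-scaleʳ a b c N = trans
  (sum-cong′ (suc N) (λ k → solve 4 (λ d u v w → d :* u :* (v :* w) := d :* u :* v :* w)
    refl (toℚ (N C k)) (a k) (b (N ℕ.∸ k)) c))
  (sum-*ʳ (suc N) _ c)

-- Leibniz rule: ⋆ behaves like a product of exponential generating functions,
-- and shifting a sequence is differentiating its generating function.
⋆-leibniz : ∀ (a b : Seq) N → (a ⋆ b) (suc N) ≡ (shift a ⋆ b) N + (a ⋆ shift b) N
⋆-leibniz a b N = begin
  (a ⋆ b) (suc N)                                            ≡⟨ sum-first (suc N) _ ⟩
  head + sumℚ (suc N) (λ k → toℚ (suc N C suc k) * a (suc k) * b (N ℕ.∸ k))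
    ≡⟨ cong (_+_ head) (trans (sum-cong′ (suc N) pascal-split) (sum-+ (suc N) _ _)) ⟩
  head + ((shift a ⋆ b) N + sumℚ (suc N) upper)              ≡⟨ cong (λ z → head + ((shift a ⋆ b) N + z)) upper-reindexed ⟩
  head + ((shift a ⋆ b) N + sumℚ N upper′)
    ≡⟨ solve 3 (λ x y z → x :+ (y :+ z) := y :+ (x :+ z)) refl head ((shift a ⋆ b) N) (sumℚ N upper′) ⟩
  (shift a ⋆ b) N + (head + sumℚ N upper′)                   ≡⟨ cong (_+_ ((shift a ⋆ b) N)) (sym (sum-first N _)) ⟩
  (shift a ⋆ b) N + (a ⋆ shift b) N                          ∎
  where
  open ≡-Reasoning
  head : ℚ
  head = toℚ (suc N C 0) * a 0 * b (suc N)
  -- the C(N,k+1) part of Pascal's rule, before and after reindexing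
  upper upper′ : Seq
  upper  k = toℚ (N C suc k) * a (suc k) * b (N ℕ.∸ k)
  upper′ k = toℚ (N C suc k) * a (suc k) * b (suc (N ℕ.∸ suc k))
  pascal-split : ∀ k → toℚ (suc N C suc k) * a (suc k) * b (N ℕ.∸ k)
                     ≡ toℚ (N C k) * a (suc k) * b (N ℕ.∸ k) + upper k
  pascal-split k = trans (cong (λ c → c * a (suc k) * b (N ℕ.∸ k)) (sym (pascal N k)))
    (solve 4 (λ c d u v → (c :+ d) :* u :* v := c :* u :* v :+ d :* u :* v)
      refl (toℚ (N C k)) (toℚ (N C suc k)) (a (suc k)) (b (N ℕ.∸ k)))
  -- the last term of `upper` has C(N,N+1) = 0, and N ∸ k = suc (N ∸ suc k) for k < N
  upper-reindexed : sumℚ (suc N) upper ≡ sumℚ N upper′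
  upper-reindexed = begin
    sumℚ N upper + upper N  ≡⟨ cong (λ c → sumℚ N upper + toℚ c * a (suc N) * b (N ℕ.∸ N)) (k>n⇒nCk≡0 (ℕP.n<1+n N)) ⟩
    sumℚ N upper + 0ℚ * a (suc N) * b (N ℕ.∸ N)
      ≡⟨ solve 3 (λ s u v → s :+ con 0ℚ :* u :* v := s) refl (sumℚ N upper) (a (suc N)) (b (N ℕ.∸ N)) ⟩
    sumℚ N upper            ≡⟨ sum-cong N (λ k k<N → cong (λ i → toℚ (N C suc k) * a (suc k) * b i)
                                               (ℕP.+-∸-assoc 1 k<N)) ⟩
    sumℚ N upper′           ∎

⋆-comm : ∀ N (a b : Seq) → (a ⋆ b) N ≡ (b ⋆ a) N
⋆-comm zero    a b = trans (⋆-at-0 a b) (trans (*-comm (a 0) (b 0)) (sym (⋆-at-0 b a)))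
⋆-comm (suc N) a b = begin
  (a ⋆ b) (suc N)                        ≡⟨ ⋆-leibniz a b N ⟩
  (shift a ⋆ b) N + (a ⋆ shift b) N      ≡⟨ cong₂ _+_ (⋆-comm N (shift a) b) (⋆-comm N a (shift b)) ⟩
  (b ⋆ shift a) N + (shift b ⋆ a) N      ≡⟨ +-comm ((b ⋆ shift a) N) ((shift b ⋆ a) N) ⟩
  (shift b ⋆ a) N + (b ⋆ shift a) N      ≡⟨ sym (⋆-leibniz b a N) ⟩
  (b ⋆ a) (suc N)                        ∎
  where open ≡-Reasoning

-- Left-commutativity a ⋆ (b ⋆ c) = b ⋆ (a ⋆ c), by induction with the Leibniz rule;
-- this is the form of associativity that moves the 𝟙 of the binomial theorem outward.
⋆-leftComm : ∀ N (a b c : Seq) → (a ⋆ (b ⋆ c)) N ≡ (b ⋆ (a ⋆ c)) N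
⋆-leftComm zero    a b c = begin
  (a ⋆ (b ⋆ c)) 0      ≡⟨ ⋆-at-0 a (b ⋆ c) ⟩
  a 0 * (b ⋆ c) 0      ≡⟨ cong (a 0 *_) (⋆-at-0 b c) ⟩
  a 0 * (b 0 * c 0)    ≡⟨ solve 3 (λ u v w → u :* (v :* w) := v :* (u :* w)) refl (a 0) (b 0) (c 0) ⟩
  b 0 * (a 0 * c 0)    ≡⟨ cong (b 0 *_) (sym (⋆-at-0 a c)) ⟩
  b 0 * (a ⋆ c) 0      ≡⟨ sym (⋆-at-0 b (a ⋆ c)) ⟩
  (b ⋆ (a ⋆ c)) 0      ∎
  where open ≡-Reasoning
⋆-leftComm (suc N) a b c = begin
  (a ⋆ (b ⋆ c)) (suc N)                                       ≡⟨ ⋆-leibniz a (b ⋆ c) N ⟩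
  (shift a ⋆ (b ⋆ c)) N + (a ⋆ shift (b ⋆ c)) N                ≡⟨ cong (_+_ ((shift a ⋆ (b ⋆ c)) N)) (leibniz-inside a b c) ⟩
  (shift a ⋆ (b ⋆ c)) N + ((a ⋆ (shift b ⋆ c)) N + (a ⋆ (b ⋆ shift c)) N)
    ≡⟨ cong₂ _+_ (⋆-leftComm N (shift a) b c) (cong₂ _+_ (⋆-leftComm N a (shift b) c) (⋆-leftComm N a b (shift c))) ⟩
  (b ⋆ (shift a ⋆ c)) N + ((shift b ⋆ (a ⋆ c)) N + (b ⋆ (a ⋆ shift c)) N)
    ≡⟨ solve 3 (λ x y z → x :+ (y :+ z) := y :+ (x :+ z)) refl
         ((b ⋆ (shift a ⋆ c)) N) ((shift b ⋆ (a ⋆ c)) N) ((b ⋆ (a ⋆ shift c)) N) ⟩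
  (shift b ⋆ (a ⋆ c)) N + ((b ⋆ (shift a ⋆ c)) N + (b ⋆ (a ⋆ shift c)) N)
    ≡⟨ cong (_+_ ((shift b ⋆ (a ⋆ c)) N)) (sym (leibniz-inside b a c)) ⟩
  (shift b ⋆ (a ⋆ c)) N + (b ⋆ shift (a ⋆ c)) N               ≡⟨ sym (⋆-leibniz b (a ⋆ c) N) ⟩
  (b ⋆ (a ⋆ c)) (suc N)                                       ∎
  where
  open ≡-Reasoning
  leibniz-inside : ∀ (a b c : Seq) → (a ⋆ shift (b ⋆ c)) N ≡ (a ⋆ (shift b ⋆ c)) N + (a ⋆ (b ⋆ shift c)) N
  leibniz-inside a b c = trans (⋆-congʳ a (⋆-leibniz b c) N) (⋆-distribʳ a (shift b ⋆ c) (b ⋆ shift c) N)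

-- The constant sequence 𝟙; convolving with it is the binomial transform,
-- and it is invariant under shift.
𝟙 : Seq
𝟙 _ = 1ℚ

binomial-theorem : ∀ x N → powℚ (x + 1ℚ) N ≡ (𝟙 ⋆ powℚ x) N
binomial-theorem x zero    = refl
binomial-theorem x (suc N) = begin
  powℚ (x + 1ℚ) N * (x + 1ℚ)                  ≡⟨ cong (_* (x + 1ℚ)) (binomial-theorem x N) ⟩
  (𝟙 ⋆ powℚ x) N * (x + 1ℚ)                   ≡⟨ solve 2 (λ p x → p :* (x :+ con 1ℚ) := p :+ p :* x) refl ((𝟙 ⋆ powℚ x) N) x ⟩
  (𝟙 ⋆ powℚ x) N + (𝟙 ⋆ powℚ x) N * x         ≡⟨ cong (_+_ ((𝟙 ⋆ powℚ x) N)) (sym (⋆-scaleʳ 𝟙 (powℚ x) x N)) ⟩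
  (shift 𝟙 ⋆ powℚ x) N + (𝟙 ⋆ shift (powℚ x)) N ≡⟨ sym (⋆-leibniz 𝟙 (powℚ x) N) ⟩
  (𝟙 ⋆ powℚ x) (suc N)                        ∎
  where open ≡-Reasoning

appell-shift : ∀ (d c : Seq) x N → (d ⋆ (c ⋆ powℚ (x + 1ℚ))) N ≡ (𝟙 ⋆ (d ⋆ (c ⋆ powℚ x))) N
appell-shift d c x N = begin
  (d ⋆ (c ⋆ powℚ (x + 1ℚ))) N    ≡⟨ ⋆-congʳ d (⋆-congʳ c (binomial-theorem x)) N ⟩
  (d ⋆ (c ⋆ (𝟙 ⋆ powℚ x))) N     ≡⟨ ⋆-congʳ d (λ k → ⋆-leftComm k c 𝟙 (powℚ x)) N ⟩
  (d ⋆ (𝟙 ⋆ (c ⋆ powℚ x))) N     ≡⟨ ⋆-leftComm N d 𝟙 (c ⋆ powℚ x) ⟩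
  (𝟙 ⋆ (d ⋆ (c ⋆ powℚ x))) N     ∎
  where open ≡-Reasoning

δ : ℕ → Seq
δ zero    zero    = 1ℚ
δ zero    (suc k) = 0ℚ
δ (suc ν) zero    = 0ℚ
δ (suc ν) (suc k) = δ ν k

sum-zero : ∀ n → sumℚ n (λ _ → 0ℚ) ≡ 0ℚ
sum-zero zero    = refl
sum-zero (suc n) rewrite sum-zero n = refl

-- N ∸ ν = suc (N ∸ suc ν) whenever C(N, ν+1) ≠ 0.
reindex-under-binomial : ∀ N ν (p : Seq) →
  toℚ (N C suc ν) * p (suc (N ℕ.∸ suc ν)) ≡ toℚ (N C suc ν) * p (N ℕ.∸ ν)
reindex-under-binomial N ν p with ν ℕ.<? N
... | yes ν<N = cong (λ i → toℚ (N C suc ν) * p i) (sym (ℕP.+-∸-assoc 1 ν<N))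
... | no  ν≮N rewrite k>n⇒nCk≡0 (s≤s (ℕP.≮⇒≥ ν≮N)) =
  trans (*-zeroˡ (p (suc (N ℕ.∸ suc ν)))) (sym (*-zeroˡ (p (N ℕ.∸ ν))))

δ-⋆ : ∀ ν N (p : Seq) → (δ ν ⋆ p) N ≡ toℚ (N C ν) * p (N ℕ.∸ ν)
δ-⋆ zero    N       p = begin
  (δ 0 ⋆ p) N                                            ≡⟨ sum-first N _ ⟩
  1ℚ * 1ℚ * p N + sumℚ N (λ k → toℚ (N C suc k) * 0ℚ * p (N ℕ.∸ suc k))
    ≡⟨ cong (_+_ (1ℚ * 1ℚ * p N)) (trans (sum-cong′ N (λ k → vanishes (toℚ (N C suc k)) (p (N ℕ.∸ suc k)))) (sum-zero N)) ⟩
  1ℚ * 1ℚ * p N + 0ℚ                                     ≡⟨ solve 1 (λ v → con 1ℚ :* con 1ℚ :* v :+ con 0ℚ := con 1ℚ :* v) refl (p N) ⟩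
  1ℚ * p N                                               ∎
  where
  open ≡-Reasoning
  vanishes : ∀ c v → c * 0ℚ * v ≡ 0ℚ
  vanishes = solve 2 (λ c v → c :* con 0ℚ :* v := con 0ℚ) refl
δ-⋆ (suc ν) zero    p = ⋆-at-0 (δ (suc ν)) p
δ-⋆ (suc ν) (suc N) p = begin
  (δ (suc ν) ⋆ p) (suc N)                                          ≡⟨ ⋆-leibniz (δ (suc ν)) p N ⟩
  (δ ν ⋆ p) N + (δ (suc ν) ⋆ shift p) N                            ≡⟨ cong₂ _+_ (δ-⋆ ν N p) (δ-⋆ (suc ν) N (shift p)) ⟩
  toℚ (N C ν) * p (N ℕ.∸ ν) + toℚ (N C suc ν) * p (suc (N ℕ.∸ suc ν))
    ≡⟨ cong (_+_ (toℚ (N C ν) * p (N ℕ.∸ ν))) (reindex-under-binomial N ν p) ⟩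
  toℚ (N C ν) * p (N ℕ.∸ ν) + toℚ (N C suc ν) * p (N ℕ.∸ ν)      ≡⟨ sym (*-distribʳ-+ (p (N ℕ.∸ ν)) (toℚ (N C ν)) (toℚ (N C suc ν))) ⟩
  (toℚ (N C ν) + toℚ (N C suc ν)) * p (N ℕ.∸ ν)                   ≡⟨ cong (_* p (N ℕ.∸ ν)) (pascal N ν) ⟩
  toℚ (suc N C suc ν) * p (N ℕ.∸ ν)                                ∎
  where open ≡-Reasoning

-- Forward differences of a binomial transform: for G = 𝟙 ⋆ q,
--   Σₖ C(n,k) (-1)ⁿ⁻ᵏ G(m+k) = Σⱼ C(m,j) q(n+j),
-- i.e. Δⁿ G (m) = (𝟙 ⋆ shiftⁿ q)(m), read through the commutativity of ⋆.
difference-of-binomial-transform : ∀ (q : Seq) n m →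
  ((λ k → (𝟙 ⋆ q) (m ℕ.+ k)) ⋆ signℚ) n ≡ ((λ j → q (n ℕ.+ j)) ⋆ 𝟙) m
difference-of-binomial-transform q zero    m = begin
  ((λ k → (𝟙 ⋆ q) (m ℕ.+ k)) ⋆ signℚ) 0   ≡⟨ ⋆-at-0 (λ k → (𝟙 ⋆ q) (m ℕ.+ k)) signℚ ⟩
  (𝟙 ⋆ q) (m ℕ.+ 0) * 1ℚ                  ≡⟨ *-identityʳ ((𝟙 ⋆ q) (m ℕ.+ 0)) ⟩
  (𝟙 ⋆ q) (m ℕ.+ 0)                       ≡⟨ cong (𝟙 ⋆ q) (ℕP.+-identityʳ m) ⟩
  (𝟙 ⋆ q) m                               ≡⟨ ⋆-comm m 𝟙 q ⟩
  (q ⋆ 𝟙) m                               ∎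
  where open ≡-Reasoning
difference-of-binomial-transform q (suc n) m = begin
  (F ⋆ signℚ) (suc n)                                      ≡⟨ ⋆-leibniz F signℚ n ⟩
  (shift F ⋆ signℚ) n + (F ⋆ shift signℚ) n
    ≡⟨ cong₂ _+_ (⋆-congˡ signℚ (λ k → cong (𝟙 ⋆ q) (ℕP.+-suc m k)) n)
                 (trans (⋆-congʳ F sign-step n) (⋆-scaleʳ F signℚ (- 1ℚ) n)) ⟩
  ((λ k → (𝟙 ⋆ q) (suc m ℕ.+ k)) ⋆ signℚ) n + (F ⋆ signℚ) n * (- 1ℚ)
    ≡⟨ cong₂ (λ u v → u + v * (- 1ℚ)) (difference-of-binomial-transform q n (suc m))
                                      (difference-of-binomial-transform q n m) ⟩
  (qₙ ⋆ 𝟙) (suc m) + (qₙ ⋆ 𝟙) m * (- 1ℚ)                  ≡⟨ cong (λ u → u + (qₙ ⋆ 𝟙) m * (- 1ℚ)) (⋆-leibniz qₙ 𝟙 m) ⟩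
  (shift qₙ ⋆ 𝟙) m + (qₙ ⋆ 𝟙) m + (qₙ ⋆ 𝟙) m * (- 1ℚ)
    ≡⟨ solve 2 (λ u v → u :+ v :+ v :* con (- 1ℚ) := u) refl ((shift qₙ ⋆ 𝟙) m) ((qₙ ⋆ 𝟙) m) ⟩
  (shift qₙ ⋆ 𝟙) m                                         ≡⟨ ⋆-congˡ 𝟙 (λ j → cong q (ℕP.+-suc n j)) m ⟩
  ((λ j → q (suc n ℕ.+ j)) ⋆ 𝟙) m                          ∎
  where
  open ≡-Reasoning
  F qₙ : Seq
  F  k = (𝟙 ⋆ q) (m ℕ.+ k)
  qₙ j = q (n ℕ.+ j)
  sign-step : ∀ k → signℚ (suc k) ≡ signℚ k * (- 1ℚ)
  sign-step k = solve 1 (λ s → :- s := s :* con (- 1ℚ)) refl (signℚ k)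

-- Q_y(N) = C(N,ν) B_{N-ν}(y), which is B_N⁽ᵛ⁾(y) / ν!; note that
-- bernoulliPoly N y is by definition (bernoulliNumber ⋆ powℚ y) N.
bernoulliDerivative : ℕ → ℚ → Seq
bernoulliDerivative ν y N = toℚ (N C ν) * bernoulliPoly (N ℕ.∸ ν) y

bernoulliDerivative-shift : ∀ ν x N →
  bernoulliDerivative ν (x + 1ℚ) N ≡ (𝟙 ⋆ bernoulliDerivative ν x) N
bernoulliDerivative-shift ν x N = begin
  bernoulliDerivative ν (x + 1ℚ) N                  ≡⟨ sym (δ-⋆ ν N (bernoulliNumber ⋆ powℚ (x + 1ℚ))) ⟩
  (δ ν ⋆ (bernoulliNumber ⋆ powℚ (x + 1ℚ))) N       ≡⟨ appell-shift (δ ν) bernoulliNumber x N ⟩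
  (𝟙 ⋆ (δ ν ⋆ (bernoulliNumber ⋆ powℚ x))) N        ≡⟨ ⋆-congʳ 𝟙 (λ k → δ-⋆ ν k (bernoulliNumber ⋆ powℚ x)) N ⟩
  (𝟙 ⋆ bernoulliDerivative ν x) N                   ∎
  where open ≡-Reasoning

theorem1p7 : (ν m n : ℕ) → 0 < m ℕ.+ n → (x : ℚ) →
    sumℚ (suc m) (λ j → toℚ (m C j) * toℚ ((n ℕ.+ j) C ν) * bernoulliPoly ((n ℕ.+ j) ℕ.∸ ν) x)
    ≡ sumℚ (suc n) (λ k → signℚ (n ℕ.∸ k) * toℚ (n C k) * toℚ ((m ℕ.+ k) C ν) * bernoulliPoly ((m ℕ.+ k) ℕ.∸ ν) (x + 1ℚ))
theorem1p7 ν m n _ x = begin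
  sumℚ (suc m) (λ j → toℚ (m C j) * toℚ ((n ℕ.+ j) C ν) * bernoulliPoly ((n ℕ.+ j) ℕ.∸ ν) x)
    ≡⟨ sum-cong′ (suc m) (λ j → solve 3 (λ a b c → a :* b :* c := a :* (b :* c) :* con 1ℚ) refl
         (toℚ (m C j)) (toℚ ((n ℕ.+ j) C ν)) (bernoulliPoly ((n ℕ.+ j) ℕ.∸ ν) x)) ⟩
  ((λ j → Qₓ (n ℕ.+ j)) ⋆ 𝟙) m                        ≡⟨ sym (difference-of-binomial-transform Qₓ n m) ⟩
  ((λ k → (𝟙 ⋆ Qₓ) (m ℕ.+ k)) ⋆ signℚ) n              ≡⟨ ⋆-congˡ signℚ (λ k → sym (bernoulliDerivative-shift ν x (m ℕ.+ k))) n ⟩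
  ((λ k → bernoulliDerivative ν (x + 1ℚ) (m ℕ.+ k)) ⋆ signℚ) n
    ≡⟨ sum-cong′ (suc n) (λ k → solve 4 (λ a b c d → a :* (b :* c) :* d := d :* a :* b :* c) refl
         (toℚ (n C k)) (toℚ ((m ℕ.+ k) C ν)) (bernoulliPoly ((m ℕ.+ k) ℕ.∸ ν) (x + 1ℚ)) (signℚ (n ℕ.∸ k))) ⟩
  sumℚ (suc n) (λ k → signℚ (n ℕ.∸ k) * toℚ (n C k) * toℚ ((m ℕ.+ k) C ν) * bernoulliPoly ((m ℕ.+ k) ℕ.∸ ν) (x + 1ℚ)) ∎
  where
  open ≡-Reasoning
  Qₓ : Seq
  Qₓ = bernoulliDerivative ν x
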